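{- Let $r\ge1$, $a_1\le\cdots\le a_r$ nonnegative integers and $f(x)=(x+a_1)\cdots(x+a_r)$. For all $j,n\in\mathbb{N}$, $E_{j,n}^f=e_{n-j}(f(1),\dots,f(n-1))$ equals the number of $f$-Stirling $r$-tuples of permutations of order $(n,j)$.
   Context: $e_m$ is the elementary symmetric polynomial of degree $m$ ($e_0=1$; $e_m=0$ if $m<0$ or $m$ exceeds the number of variables). An $r$-tuple $(\pi_1,\dots,\pi_r)$ with $\pi_i\in S_{n+a_i}$ is $f$-Stirling of order $(n,j)$ if (a) each $\pi_i$ has exactly $j+a_i$ cycles; (b) the sets of cycle maxima (largest elements of cycles) of $\pi_1,\dots,\pi_r$ that are less than $n+1$ coincide; (c) for each $i$, the orbits of $n,n+1,\dots,n+a_i$ under $\pi_i$ are pairwise distinct. -}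

module Defs where

open import Data.Bool using (Bool; true; false; _∧_; if_then_else_)
open import Data.Nat using (ℕ; zero; suc; _+_; _*_; _∸_; _≤_; _<_; _≤?_; _<?_)
import Data.Nat as ℕ
open import Data.Fin as Fin using (Fin; toℕ)
open import Data.List using (List; []; _∷_; [_]; map; concatMap; allFin; length; filterᵇ; applyUpTo)
open import Data.Bool.ListAction using (all; any)
open import Data.Nat.ListAction using (product)
open import Relation.Nullary using (yes; no)
open import Data.Vec using (Vec; []; _∷_; lookup; toList)
open import Data.Product using (_×_; _,_)
open import Data.Unit using (⊤; tt)
open import Relation.Nullary.Decidable using (⌊_⌋)

esym : ℕ → List ℕ → ℕ
esym zero    _        = 1
esym (suc m) []       = 0
esym (suc m) (x ∷ xs) = x * esym m xs + esym (suc m) xs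

esymZ : ℕ → ℕ → List ℕ → ℕ
esymZ n j xs = if ⌊ j ≤? n ⌋ then esym (n ∸ j) xs else 0

fpoly : ∀ {r} → Vec ℕ r → ℕ → ℕ
fpoly a x = product (map (λ ai → x + ai) (toList a))

E : ∀ {r} → Vec ℕ r → ℕ → ℕ → ℕ
E a j n = esymZ n j (applyUpTo (λ k → fpoly a (suc k)) (n ∸ 1))

-- Permutations of [m] = {1,…,m}.  The element k ∈ [m] is encoded by the
-- index (k - 1) : Fin m; a map [m] → [m] is the vector of its values.

FinMap : ℕ → Set
FinMap m = Vec (Fin m) m

_==_ : ∀ {m} → Fin m → Fin m → Bool
x == y = ⌊ x Fin.≟ y ⌋

allVecs : (m k : ℕ) → List (Vec (Fin m) k)
allVecs m zero    = [ [] ]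
allVecs m (suc k) = concatMap (λ x → map (x ∷_) (allVecs m k)) (allFin m)

isPerm : ∀ {m} → FinMap m → Bool
isPerm {m} v = all (λ x → all (λ y → if lookup v x == lookup v y then x == y else true) (allFin m)) (allFin m)

allPerms : (m : ℕ) → List (FinMap m)
allPerms m = filterᵇ isPerm (allVecs m m)

iter : ∀ {m} → FinMap m → ℕ → Fin m → Fin m
iter v zero    x = x
iter v (suc k) x = lookup v (iter v k x)

sameOrbit : ∀ {m} → FinMap m → Fin m → Fin m → Bool
sameOrbit {m} v x y = any (λ k → iter v k x == y) (applyUpTo (λ k → k) m)

isCycleMax : ∀ {m} → FinMap m → Fin m → Bool
isCycleMax {m} v x = all (λ k → ⌊ toℕ (iter v k x) ≤? toℕ x ⌋) (applyUpTo (λ k → k) m)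

-- number of cycles = number of cycle maxima (each cycle has exactly one maximum)
numCycles : ∀ {m} → FinMap m → ℕ
numCycles {m} v = length (filterᵇ (isCycleMax v) (allFin m))

-- for each element k of [m] with k < n+1 (i.e. k ≤ n), whether k is a cycle
-- maximum: the characteristic vector of {cycle maxima} ∩ {1,…,n}
-- (elements beyond m are recorded as false; unused in practice since n ≤ m).
maxSetBelow : ∀ {m} → ℕ → FinMap m → List Bool
maxSetBelow {m} n v = applyUpTo (λ k → atIndex k) n
  where
  atIndex : ℕ → Bool
  atIndex k with k <? m
  ... | yes k<m = isCycleMax v (Fin.fromℕ< k<m)
  ... | no _    = false

-- (c): the orbits of the elements n, n+1, …, n+a of [n+a] are pairwise distinct
-- (element index x encodes element toℕ x + 1)
distinctOrbitsFrom : ∀ {m} → ℕ → FinMap m → Bool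
distinctOrbitsFrom {m} n v =
  all (λ x → all (λ y →
    if ⌊ n ≤? suc (toℕ x) ⌋ ∧ ⌊ n ≤? suc (toℕ y) ⌋ ∧ sameOrbit v x y
    then x == y else true) (allFin m)) (allFin m)

Tuple : ℕ → ∀ {r} → Vec ℕ r → Set
Tuple n []       = ⊤
Tuple n (a ∷ as) = FinMap (n + a) × Tuple n as

allTuples : (n : ℕ) → ∀ {r} → (as : Vec ℕ r) → List (Tuple n as)
allTuples n []       = [ tt ]
allTuples n (a ∷ as) = concatMap (λ p → map (p ,_) (allTuples n as)) (allPerms (n + a))

_==L_ : List Bool → List Bool → Bool
[] ==L [] = true
(x ∷ xs) ==L (y ∷ ys) = ⌊ x Data.Bool.≟ y ⌋ ∧ (xs ==L ys)
  where import Data.Bool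
_ ==L _ = false

-- conditions (a), (c) for each component, and (b): every component has the
-- same set of cycle maxima below n+1 as the given reference set S
condAll : (n j : ℕ) → List Bool → ∀ {r} → (as : Vec ℕ r) → Tuple n as → Bool
condAll n j S []       tt       = true
condAll n j S (a ∷ as) (p , ps) =
  ⌊ numCycles p ℕ.≟ j + a ⌋ ∧ (maxSetBelow n p ==L S) ∧ distinctOrbitsFrom n p
  ∧ condAll n j S as ps

isFStirling : (n j : ℕ) → ∀ {r} → (as : Vec ℕ r) → Tuple n as → Bool
isFStirling n j []       tt       = true
isFStirling n j (a ∷ as) (p , ps) = condAll n j (maxSetBelow n p) (a ∷ as) (p , ps)

numFStirling : ∀ {r} → Vec ℕ r → ℕ → ℕ → ℕ
numFStirling as n j = length (filterᵇ (isFStirling n j as) (allTuples n as))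

-- Delete the element 1 from its cycle. A permutation π of [m + 1] corresponds to the pair (π 1, σ),
-- where σ is the permutation of {2, …, m + 1} so obtained. Since 1 is the least element, it is a cycle
-- maximum iff it is a fixed point (π 1 = 1); the cycle maxima and the orbits of the other elements are
-- those of σ. Let K(n, a, k, S) count the permutations of [n + a] with k cycles, set S of cycle maxima
-- below n + 1, and n, …, n + a in distinct orbits, and let S′ be S \ {1} shifted down by one. If 1 ∈ S,
-- then 1 is fixed and K(n, a, k, S) = K(n - 1, a, k - 1, S′). If 1 ∉ S, then n ≥ 2 (for n = 1 the element
-- 1 = n must be alone in its orbit) and any of the n - 1 + a values π 1 ≠ 1 is allowed, so
-- K(n, a, k, S) = (n - 1 + a) K(n - 1, a, k, S′). The number of f-Stirling tuples is the sum over S of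
-- ∏ᵢ K(n, aᵢ, j + aᵢ, S), so it satisfies N(n, j) = N(n - 1, j - 1) + f(n - 1) N(n - 1, j): the
-- expansion of e_{n-j}(f(1), …, f(n - 1)) in its last variable, with the same initial values.

module Submission where

open import Defs
open import Data.Bool as Bool using (Bool; true; false; _∧_; T; if_then_else_)
open import Data.Bool.ListAction using (all; any)
open import Data.Bool.Properties using (T-∧; ∧-assoc; ∧-zeroʳ; ∧-identityʳ)
open import Data.Empty using (⊥-elim)
open import Data.Fin as Fin using (Fin; zero; suc; _≟_; toℕ)
import Data.Fin.Permutation as Perm
import Data.Fin.Permutation.Components as PC
open import Data.Fin.Properties as Finₚ using (0≢1+n; toℕ-injective; pigeonhole; toℕ<n)
open import Data.List
  using (List; []; _∷_; [_]; map; concatMap; allFin; length; filterᵇ; _++_; tabulate; applyUpTo; _∷ʳ_)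
open import Data.List.Properties using (length-applyUpTo; applyUpTo-∷ʳ)
open import Data.List.Relation.Unary.All.Properties as All using (all⁺; all⁻)
open import Data.List.Relation.Unary.Any.Properties as Any using (any⁺; any⁻)
open import Data.Nat as ℕ using (ℕ; zero; suc; _+_; _*_; _∸_; _≤_; _<_; _≤?_; _<?_; z≤n; s≤s; s≤s⁻¹; s<s; s<s⁻¹)
open import Data.Nat.Induction using (<-rec)
open import Data.Nat.Properties
  using (+-0-commutativeMonoid; +-commutativeSemigroup; *-commutativeSemigroup; +-assoc; +-identityʳ; *-zeroʳ;
         *-comm; *-assoc; *-distribˡ-+; suc-injective; m∸n+n≡m; +-monoʳ-<; ≤-trans; ≤-reflexive; ≤-pred; ≮⇒≥;
         n<1+n; <-≤-trans; <-trans; n≤0⇒n≡0; >⇒≢; m≢1+n+m; n≤1+n)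
open import Data.Nat.Tactic.RingSolver using (solve-∀)
open import Data.Product using (∃-syntax; _×_; _,_; proj₁; proj₂)
open import Data.Sum using (_⊎_; inj₁; inj₂)
open import Data.Unit using (tt)
open import Data.Vec as Vec using (Vec; []; _∷_; lookup)
open import Data.Vec.Properties using (lookup-map)
open import Function using (_∘_; id)
open import Function.Bundles using (_⇔_; mk⇔; Equivalence)
open import Function.Definitions using (Injective)
open import Relation.Binary.PropositionalEquality
  using (_≡_; _≢_; refl; sym; trans; cong; cong₂; subst; module ≡-Reasoning)
open import Relation.Nullary using (yes; no; ¬_)
open import Relation.Nullary.Decidable using (⌊_⌋; toWitness; fromWitness; isYes≗does; dec-true; dec-false)
open import Algebra.Properties.CommutativeMonoid.Sum +-0-commutativeMonoid
  using (sum; sum-cong-≗; sum-permute; sum-replicate-zero)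
open import Algebra.Properties.CommutativeSemigroup +-commutativeSemigroup
  using () renaming (interchange to +-interchange)
open import Algebra.Properties.CommutativeSemigroup *-commutativeSemigroup
  using () renaming (interchange to *-interchange)

open Equivalence using (to; from)

private
  variable
    A B : Set

⟦_⟧ : Bool → ℕ
⟦ true  ⟧ = 1
⟦ false ⟧ = 0

⟦∧⟧ : ∀ b c → ⟦ b ∧ c ⟧ ≡ ⟦ b ⟧ * ⟦ c ⟧
⟦∧⟧ true  c = sym (+-identityʳ ⟦ c ⟧)
⟦∧⟧ false c = refl

sumBy : List A → (A → ℕ) → ℕ
sumBy []       g = 0
sumBy (x ∷ xs) g = g x + sumBy xs g

syntax sumBy xs (λ x → e) = ∑[ x ← xs ] e

sumBy-cong : ∀ xs {g h : A → ℕ} → (∀ x → g x ≡ h x) → sumBy xs g ≡ sumBy xs h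
sumBy-cong []       g≗h = refl
sumBy-cong (x ∷ xs) g≗h = cong₂ _+_ (g≗h x) (sumBy-cong xs g≗h)

sumBy-zero : ∀ xs {g : A → ℕ} → (∀ x → g x ≡ 0) → sumBy xs g ≡ 0
sumBy-zero []       g≗0 = refl
sumBy-zero (x ∷ xs) g≗0 = cong₂ _+_ (g≗0 x) (sumBy-zero xs g≗0)

sumBy-++ : ∀ xs ys (g : A → ℕ) → sumBy (xs ++ ys) g ≡ sumBy xs g + sumBy ys g
sumBy-++ []       ys g = refl
sumBy-++ (x ∷ xs) ys g = trans (cong (g x +_) (sumBy-++ xs ys g)) (sym (+-assoc (g x) _ _))

sumBy-map : ∀ (f : B → A) xs (g : A → ℕ) → sumBy (map f xs) g ≡ sumBy xs (g ∘ f)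
sumBy-map f []       g = refl
sumBy-map f (x ∷ xs) g = cong (g (f x) +_) (sumBy-map f xs g)

sumBy-concatMap : ∀ (f : B → List A) xs (g : A → ℕ) →
                  sumBy (concatMap f xs) g ≡ ∑[ x ← xs ] sumBy (f x) g
sumBy-concatMap f []       g = refl
sumBy-concatMap f (x ∷ xs) g =
  trans (sumBy-++ (f x) _ g) (cong (sumBy (f x) g +_) (sumBy-concatMap f xs g))

sumBy-*ˡ : ∀ xs c (g : A → ℕ) → ∑[ x ← xs ] (c * g x) ≡ c * sumBy xs g
sumBy-*ˡ []       c g = sym (*-zeroʳ c)
sumBy-*ˡ (x ∷ xs) c g = trans (cong (c * g x +_) (sumBy-*ˡ xs c g)) (sym (*-distribˡ-+ c (g x) _))

sumBy-*ʳ : ∀ xs (g : A → ℕ) c → ∑[ x ← xs ] (g x * c) ≡ sumBy xs g * c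
sumBy-*ʳ xs g c =
  trans (sumBy-cong xs (λ x → *-comm (g x) c)) (trans (sumBy-*ˡ xs c g) (*-comm c _))

sumBy-filterᵇ : ∀ (p : A → Bool) xs g → sumBy (filterᵇ p xs) g ≡ ∑[ x ← xs ] (⟦ p x ⟧ * g x)
sumBy-filterᵇ p []       g = refl
sumBy-filterᵇ p (x ∷ xs) g with p x
... | true  = cong₂ _+_ (sym (+-identityʳ (g x))) (sumBy-filterᵇ p xs g)
... | false = sumBy-filterᵇ p xs g

length-filterᵇ : ∀ (p : A → Bool) xs → length (filterᵇ p xs) ≡ ∑[ x ← xs ] ⟦ p x ⟧
length-filterᵇ p []       = refl
length-filterᵇ p (x ∷ xs) with p x
... | true  = cong suc (length-filterᵇ p xs)
... | false = length-filterᵇ p xs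

sumBy-tabulate : ∀ {m} (f : Fin m → A) (g : A → ℕ) → sumBy (tabulate f) g ≡ sum (g ∘ f)
sumBy-tabulate {m = zero}  f g = refl
sumBy-tabulate {m = suc m} f g = cong (g (f zero) +_) (sumBy-tabulate (f ∘ suc) g)

sumBy-allFin : ∀ {m} (g : Fin m → ℕ) → sumBy (allFin m) g ≡ sum g
sumBy-allFin = sumBy-tabulate id

sumBy-+ : ∀ (xs : List A) (g h : A → ℕ) → ∑[ x ← xs ] (g x + h x) ≡ sumBy xs g + sumBy xs h
sumBy-+ []       g h = refl
sumBy-+ (x ∷ xs) g h = trans (cong (g x + h x +_) (sumBy-+ xs g h)) (+-interchange (g x) (h x) _ _)

sumBy-comm : ∀ (xs : List A) (ys : List B) (g : A → B → ℕ) →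
             ∑[ x ← xs ] sumBy ys (g x) ≡ ∑[ y ← ys ] ∑[ x ← xs ] g x y
sumBy-comm []       ys g = sym (sumBy-zero ys (λ _ → refl))
sumBy-comm (x ∷ xs) ys g =
  trans (cong (sumBy ys (g x) +_) (sumBy-comm xs ys g)) (sym (sumBy-+ ys (g x) _))

sum-zero : ∀ {n} {f : Fin n → ℕ} → (∀ i → f i ≡ 0) → sum f ≡ 0
sum-zero {n} f≗0 = trans (sum-cong-≗ f≗0) (sum-replicate-zero n)

sum-const : ∀ n c → sum {n} (λ _ → c) ≡ n * c
sum-const zero    c = refl
sum-const (suc n) c = cong (c +_) (sum-const n c)

applyUpTo-cong : ∀ {f g : ℕ → A} → (∀ k → f k ≡ g k) → ∀ n → applyUpTo f n ≡ applyUpTo g n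
applyUpTo-cong f≗g zero    = refl
applyUpTo-cong f≗g (suc n) = cong₂ _∷_ (f≗g 0) (applyUpTo-cong (λ k → f≗g (suc k)) n)

T-ext : ∀ {b c} → (T b → T c) → (T c → T b) → b ≡ c
T-ext {false} {false} _ _ = refl
T-ext {false} {true}  _ f = ⊥-elim (f tt)
T-ext {true}  {false} f _ = ⊥-elim (f tt)
T-ext {true}  {true}  _ _ = refl

T-implies : ∀ b {c} → T (if b then c else true) ⇔ (T b → T c)
T-implies true  = mk⇔ (λ c _ → c) (λ f → f tt)
T-implies false = mk⇔ (λ _ ()) (λ _ → tt)

T-all-allFin : ∀ {m} (p : Fin m → Bool) → T (all p (allFin m)) ⇔ (∀ i → T (p i))
T-all-allFin {m} p = mk⇔ (All.tabulate⁻ ∘ all⁺ p (allFin m)) (all⁻ p ∘ All.tabulate⁺)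

T-all-upTo : ∀ (p : ℕ → Bool) m → T (all p (applyUpTo id m)) ⇔ (∀ {k} → k < m → T (p k))
T-all-upTo p m =
  mk⇔ (All.applyUpTo⁻ id m ∘ all⁺ p (applyUpTo id m)) (all⁻ p ∘ All.applyUpTo⁺₁ id m)

T-any-upTo : ∀ (p : ℕ → Bool) m → T (any p (applyUpTo id m)) ⇔ (∃[ k ] k < m × T (p k))
T-any-upTo p m =
  mk⇔ (Any.applyUpTo⁻ id ∘ any⁻ p _) (λ (_ , k<m , pk) → any⁺ p (Any.applyUpTo⁺ id pk k<m))

≟-suc : ∀ a b → ⌊ suc a ℕ.≟ suc b ⌋ ≡ ⌊ a ℕ.≟ b ⌋
≟-suc a b = T-ext (fromWitness ∘ suc-injective ∘ toWitness) (fromWitness ∘ cong suc ∘ toWitness)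

≟-refl : ∀ a → ⌊ a ℕ.≟ a ⌋ ≡ true
≟-refl a = trans (isYes≗does (a ℕ.≟ a)) (dec-true (a ℕ.≟ a) refl)

≟-≢ : ∀ {a b} → a ≢ b → ⌊ a ℕ.≟ b ⌋ ≡ false
≟-≢ {a} {b} a≢b = trans (isYes≗does (a ℕ.≟ b)) (dec-false (a ℕ.≟ b) a≢b)

==L-length : ∀ xs ys → length xs ≢ length ys → (xs ==L ys) ≡ false
==L-length []       []       ne = ⊥-elim (ne refl)
==L-length []       (_ ∷ _)  ne = refl
==L-length (_ ∷ _)  []       ne = refl
==L-length (x ∷ xs) (y ∷ ys) ne =
  trans (cong (⌊ x Bool.≟ y ⌋ ∧_) (==L-length xs ys (ne ∘ cong suc))) (∧-zeroʳ _)

iter-+ : ∀ {m} (v : FinMap m) k l x → iter v (k + l) x ≡ iter v k (iter v l x)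
iter-+ v zero    l x = refl
iter-+ v (suc k) l x = cong (lookup v) (iter-+ v k l x)

-- Two of the first m + 1 iterates coincide, and from there on the orbit is periodic.
iter-bounded : ∀ {m} (v : FinMap m) x k → ∃[ k' ] k' < m × iter v k' x ≡ iter v k x
iter-bounded {suc m} v x with pigeonhole (n<1+n (suc m)) (λ i → iter v (toℕ i) x)
... | i , j , i<j , xᵢ≡xⱼ = <-rec _ reduce
  where
  reduce : ∀ k → (∀ {k'} → k' < k → ∃[ k'' ] k'' < suc m × iter v k'' x ≡ iter v k' x) →
           ∃[ k' ] k' < suc m × iter v k' x ≡ iter v k x
  reduce k rec with k <? toℕ j
  ... | yes k<j = k , <-≤-trans k<j (≤-pred (toℕ<n j)) , refl
  ... | no  k≮j = let (k' , k'<m , eq) = rec shorter in k' , k'<m , trans eq (sym skip)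
    where
    p = toℕ i
    q = toℕ j
    q≤k = ≮⇒≥ k≮j
    shorter : k ∸ q + p < k
    shorter = ≤-trans (+-monoʳ-< (k ∸ q) i<j) (≤-reflexive (m∸n+n≡m q≤k))
    skip : iter v k x ≡ iter v (k ∸ q + p) x
    skip = begin
      iter v k x                  ≡⟨ cong (λ t → iter v t x) (sym (m∸n+n≡m q≤k)) ⟩
      iter v (k ∸ q + q) x        ≡⟨ iter-+ v (k ∸ q) q x ⟩
      iter v (k ∸ q) (iter v q x) ≡⟨ cong (iter v (k ∸ q)) (sym xᵢ≡xⱼ) ⟩
      iter v (k ∸ q) (iter v p x) ≡⟨ iter-+ v (k ∸ q) p x ⟨
      iter v (k ∸ q + p) x        ∎
      where open ≡-Reasoning

T-isCycleMax : ∀ {m} (v : FinMap m) x → T (isCycleMax v x) ⇔ (∀ k → toℕ (iter v k x) ≤ toℕ x)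
T-isCycleMax {m} v x = mk⇔
  (λ max k → let (k' , k'<m , eq) = iter-bounded v x k in
     subst (λ y → toℕ y ≤ toℕ x) eq (toWitness (to (T-all-upTo _ m) max k'<m)))
  (λ bound → from (T-all-upTo _ m) (λ {k} _ → fromWitness (bound k)))

T-sameOrbit : ∀ {m} (v : FinMap m) x y → T (sameOrbit v x y) ⇔ (∃[ k ] iter v k x ≡ y)
T-sameOrbit {m} v x y = mk⇔
  (λ same → let (k , _ , eq) = to (T-any-upTo _ m) same in k , toWitness eq)
  (λ (k , eq) → let (k' , k'<m , eq') = iter-bounded v x k in
     from (T-any-upTo _ m) (k' , k'<m , fromWitness (trans eq' eq)))

T-isPerm : ∀ {m} (v : FinMap m) → T (isPerm v) ⇔ Injective _≡_ _≡_ (lookup v)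
T-isPerm {m} v = mk⇔ injective perm
  where
  sameImage⇒same : Fin m → Fin m → Bool
  sameImage⇒same x y = if lookup v x == lookup v y then x == y else true
  injective : T (isPerm v) → Injective _≡_ _≡_ (lookup v)
  injective isP {x} {y} vx≡vy = toWitness (to (T-implies (lookup v x == lookup v y))
    (to (T-all-allFin (sameImage⇒same x)) (to (T-all-allFin _) isP x) y) (fromWitness vx≡vy))
  perm : Injective _≡_ _≡_ (lookup v) → T (isPerm v)
  perm inj = from (T-all-allFin _) λ x → from (T-all-allFin (sameImage⇒same x)) λ y →
    from (T-implies (lookup v x == lookup v y)) (fromWitness ∘ inj ∘ toWitness)

DistinctOrbitsFrom : ∀ {m} → ℕ → FinMap m → Set
DistinctOrbitsFrom t v = ∀ x y → t ≤ suc (toℕ x) → t ≤ suc (toℕ y) → T (sameOrbit v x y) → x ≡ y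

T-distinctOrbitsFrom : ∀ {m} t (v : FinMap m) → T (distinctOrbitsFrom t v) ⇔ DistinctOrbitsFrom t v
T-distinctOrbitsFrom {m} t v = mk⇔ distinct distinctᵇ
  where
  t≤? : Fin m → Bool
  t≤? x = ⌊ t ≤? suc (toℕ x) ⌋
  guard : Fin m → Fin m → Bool
  guard x y = t≤? x ∧ t≤? y ∧ sameOrbit v x y
  distinct : T (distinctOrbitsFrom t v) → DistinctOrbitsFrom t v
  distinct dist x y t≤x t≤y same = toWitness (to (T-implies (guard x y))
    (to (T-all-allFin _) (to (T-all-allFin _) dist x) y)
    (from (T-∧ {t≤? x}) (fromWitness t≤x , from (T-∧ {t≤? y}) (fromWitness t≤y , same))))
  distinctᵇ : DistinctOrbitsFrom t v → T (distinctOrbitsFrom t v)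
  distinctᵇ dist = from (T-all-allFin _) λ x → from (T-all-allFin _) λ y →
    from (T-implies (guard x y)) λ g →
      let (t≤x , rest) = to (T-∧ {t≤? x}) g
          (t≤y , same) = to (T-∧ {t≤? y}) rest in
      fromWitness (dist x y (toWitness t≤x) (toWitness t≤y) same)

-- Inserting the element 1

redirect : ∀ {m} → Fin (suc m) → Fin m → Fin (suc m)
redirect c = PC.transpose zero c ∘ suc

redirect-cases : ∀ {m} (c : Fin (suc m)) z →
                 (suc z ≢ c × redirect c z ≡ suc z) ⊎ (suc z ≡ c × redirect c z ≡ zero)
redirect-cases c z with suc z ≟ c
... | yes z+1≡c = inj₂ (z+1≡c , refl)
... | no  z+1≢c = inj₁ (z+1≢c , refl)

redirect-injective : ∀ {m} (c : Fin (suc m)) → Injective _≡_ _≡_ (redirect c)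
redirect-injective c {z} {w} eq = Finₚ.suc-injective (begin
  suc z                               ≡⟨ PC.transpose-inverse c zero ⟨
  PC.transpose c zero (redirect c z)  ≡⟨ cong (PC.transpose c zero) eq ⟩
  PC.transpose c zero (redirect c w)  ≡⟨ PC.transpose-inverse c zero ⟩
  suc w                               ∎)
  where open ≡-Reasoning

redirect≢c : ∀ {m} (c : Fin (suc m)) z → redirect c z ≢ c
redirect≢c c z eq with redirect-cases c z
... | inj₁ (z+1≢c , eq') = z+1≢c (trans (sym eq') eq)
... | inj₂ (z+1≡c , eq') = 0≢1+n (trans (sym eq') (trans eq (sym z+1≡c)))

sum-redirect : ∀ {m} (c : Fin (suc m)) (F : Fin (suc m) → ℕ) → sum F ≡ F c + sum (F ∘ redirect c)
sum-redirect c F = sum-permute F (Perm.transpose zero c)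

sumBy-allVecs-suc : ∀ M k (R : Vec (Fin M) (suc k) → ℕ) →
                    sumBy (allVecs M (suc k)) R ≡ sum (λ x → ∑[ w ← allVecs M k ] R (x ∷ w))
sumBy-allVecs-suc M k R = begin
  sumBy (allVecs M (suc k)) R                           ≡⟨ sumBy-concatMap _ (allFin M) R ⟩
  ∑[ x ← allFin M ] sumBy (map (x ∷_) (allVecs M k)) R  ≡⟨ sumBy-allFin (λ x → sumBy (map (x ∷_) (allVecs M k)) R) ⟩
  sum (λ x → sumBy (map (x ∷_) (allVecs M k)) R)        ≡⟨ sum-cong-≗ (λ x → sumBy-map (x ∷_) (allVecs M k) R) ⟩
  sum (λ x → ∑[ w ← allVecs M k ] R (x ∷ w))            ∎
  where open ≡-Reasoning

sumBy-allVecs-avoiding : ∀ {m} k (c : Fin (suc m)) (R : Vec (Fin (suc m)) k → ℕ) →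
                         (∀ w i → lookup w i ≡ c → R w ≡ 0) →
                         sumBy (allVecs (suc m) k) R ≡ ∑[ u ← allVecs m k ] R (Vec.map (redirect c) u)
sumBy-allVecs-avoiding zero    c R avoids = refl
sumBy-allVecs-avoiding {m} (suc k) c R avoids = begin
  sumBy (allVecs (suc m) (suc k)) R                ≡⟨ sumBy-allVecs-suc (suc m) k R ⟩
  sum (λ x → ∑[ w ← vecs ] R (x ∷ w))              ≡⟨ sum-redirect c (λ x → ∑[ w ← vecs ] R (x ∷ w)) ⟩
  ∑[ w ← vecs ] R (c ∷ w) + sum (λ z → ∑[ w ← vecs ] R (redirect c z ∷ w))
    ≡⟨ cong₂ _+_ (sumBy-zero vecs (λ w → avoids (c ∷ w) zero refl))
                 (sum-cong-≗ (λ z → sumBy-allVecs-avoiding k c _ (λ w i → avoids (redirect c z ∷ w) (suc i)))) ⟩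
  sum (λ z → ∑[ u ← allVecs m k ] R (redirect c z ∷ Vec.map (redirect c) u))
    ≡⟨ sumBy-allVecs-suc m k (R ∘ Vec.map (redirect c)) ⟨
  ∑[ u ← allVecs m (suc k) ] R (Vec.map (redirect c) u) ∎
  where
  open ≡-Reasoning
  vecs = allVecs (suc m) k

-- insert₀ c σ maps 0 to c and x + 1 to σ x + 1, or to 0 if σ x + 1 = c: the index 0 (the element 1)
-- enters a cycle of σ just before c, or becomes a fixed point if c = 0.
insert₀ : ∀ {m} → Fin (suc m) → FinMap m → FinMap (suc m)
insert₀ c σ = c ∷ Vec.map (redirect c) σ

lookup-insert₀ : ∀ {m} (c : Fin (suc m)) σ x → lookup (insert₀ c σ) (suc x) ≡ redirect c (lookup σ x)
lookup-insert₀ c σ x = lookup-map x (redirect c) σ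

isPerm-insert₀ : ∀ {m} (c : Fin (suc m)) (σ : FinMap m) → isPerm (insert₀ c σ) ≡ isPerm σ
isPerm-insert₀ c σ = T-ext
  (λ isP → from (T-isPerm σ) (shrink (to (T-isPerm (insert₀ c σ)) isP)))
  (λ isP → from (T-isPerm (insert₀ c σ)) (extend (to (T-isPerm σ) isP)))
  where
  shrink : Injective _≡_ _≡_ (lookup (insert₀ c σ)) → Injective _≡_ _≡_ (lookup σ)
  shrink inj {x} {y} eq = Finₚ.suc-injective (inj (begin
    lookup (insert₀ c σ) (suc x) ≡⟨ lookup-insert₀ c σ x ⟩
    redirect c (lookup σ x)      ≡⟨ cong (redirect c) eq ⟩
    redirect c (lookup σ y)      ≡⟨ lookup-insert₀ c σ y ⟨
    lookup (insert₀ c σ) (suc y) ∎))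
    where open ≡-Reasoning
  extend : Injective _≡_ _≡_ (lookup σ) → Injective _≡_ _≡_ (lookup (insert₀ c σ))
  extend inj {zero}  {zero}  eq = refl
  extend inj {zero}  {suc y} eq = ⊥-elim (redirect≢c c (lookup σ y) (sym (trans eq (lookup-insert₀ c σ y))))
  extend inj {suc x} {zero}  eq = ⊥-elim (redirect≢c c (lookup σ x) (trans (sym (lookup-insert₀ c σ x)) eq))
  extend inj {suc x} {suc y} eq = cong suc (inj (redirect-injective c
    (trans (sym (lookup-insert₀ c σ x)) (trans eq (lookup-insert₀ c σ y)))))

sumBy-allPerms-suc : ∀ m (g : FinMap (suc m) → ℕ) →
                     sumBy (allPerms (suc m)) g ≡ sum (λ c → ∑[ σ ← allPerms m ] g (insert₀ c σ))
sumBy-allPerms-suc m g = begin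
  sumBy (allPerms (suc m)) g                            ≡⟨ sumBy-filterᵇ isPerm (allVecs (suc m) (suc m)) g ⟩
  ∑[ v ← allVecs (suc m) (suc m) ] weight v             ≡⟨ sumBy-allVecs-suc (suc m) m weight ⟩
  sum (λ c → ∑[ w ← allVecs (suc m) m ] weight (c ∷ w))
    ≡⟨ sum-cong-≗ (λ c → sumBy-allVecs-avoiding m c (weight ∘ (c ∷_)) (nonInjective c)) ⟩
  sum (λ c → ∑[ u ← allVecs m m ] weight (insert₀ c u))
    ≡⟨ sum-cong-≗ (λ c → sumBy-cong (allVecs m m) λ u →
         cong (λ b → ⟦ b ⟧ * g (insert₀ c u)) (isPerm-insert₀ c u)) ⟩
  sum (λ c → ∑[ u ← allVecs m m ] (⟦ isPerm u ⟧ * g (insert₀ c u)))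
    ≡⟨ sum-cong-≗ (λ c → sumBy-filterᵇ isPerm (allVecs m m) (g ∘ insert₀ c)) ⟨
  sum (λ c → ∑[ σ ← allPerms m ] g (insert₀ c σ))       ∎
  where
  open ≡-Reasoning
  weight : FinMap (suc m) → ℕ
  weight v = ⟦ isPerm v ⟧ * g v
  nonInjective : ∀ c w i → lookup w i ≡ c → weight (c ∷ w) ≡ 0
  nonInjective c w i wᵢ≡c with isPerm (c ∷ w) in isP
  ... | false = refl
  ... | true  = ⊥-elim (0≢1+n (to (T-isPerm (c ∷ w)) (subst T (sym isP) tt) (sym wᵢ≡c)))

module InsertionOrbits {m} (c : Fin (suc m)) (σ : FinMap m) where

  π : FinMap (suc m)
  π = insert₀ c σ

  lookup-π : ∀ {y} {z} → y ≡ suc z → lookup π y ≡ redirect c (lookup σ z)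
  lookup-π {z = z} refl = lookup-insert₀ c σ z

  iter-lift : ∀ k x → ∃[ k' ] iter π k' (suc x) ≡ suc (iter σ k x)
  iter-lift zero    x = 0 , refl
  iter-lift (suc k) x with iter-lift k x
  ... | k' , eq with redirect-cases c (iter σ (suc k) x)
  ...   | inj₁ (_ , redir)     = suc k' , trans (lookup-π eq) redir
  ...   | inj₂ (z+1≡c , redir) = suc (suc k') , trans (cong (lookup π) (trans (lookup-π eq) redir)) (sym z+1≡c)

  iter-drop : ∀ k' x → (∃[ k ] iter π k' (suc x) ≡ suc (iter σ k x))
                     ⊎ (iter π k' (suc x) ≡ zero × ∃[ k ] c ≡ suc (iter σ k x))
  iter-drop zero     x = inj₁ (0 , refl)
  iter-drop (suc k') x with iter-drop k' x
  ... | inj₂ (eq , k , c≡) = inj₁ (k , trans (cong (lookup π) eq) c≡)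
  ... | inj₁ (k , eq) with redirect-cases c (iter σ (suc k) x)
  ...   | inj₁ (_ , redir)     = inj₁ (suc k , trans (lookup-π eq) redir)
  ...   | inj₂ (z+1≡c , redir) = inj₂ (trans (lookup-π eq) redir , suc k , sym z+1≡c)

  iter-fixed : c ≡ zero → ∀ k → iter π k zero ≡ zero
  iter-fixed c≡0 zero    = refl
  iter-fixed c≡0 (suc k) = trans (cong (lookup π) (iter-fixed c≡0 k)) c≡0

  isCycleMax-zero : isCycleMax π zero ≡ (c == zero)
  isCycleMax-zero = T-ext
    (λ max → fromWitness (toℕ-injective (n≤0⇒n≡0 (to (T-isCycleMax π zero) max 1))))
    (λ c≡0 → from (T-isCycleMax π zero) (λ k → ≤-reflexive (cong toℕ (iter-fixed (toWitness c≡0) k))))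

  isCycleMax-suc : ∀ x → isCycleMax π (suc x) ≡ isCycleMax σ x
  isCycleMax-suc x = T-ext
    (λ max → from (T-isCycleMax σ x) λ k → let (k' , eq) = iter-lift k x in
       s≤s⁻¹ (subst (λ y → toℕ y ≤ toℕ (suc x)) eq (to (T-isCycleMax π (suc x)) max k')))
    (λ max → from (T-isCycleMax π (suc x)) (bounded (to (T-isCycleMax σ x) max)))
    where
    bounded : (∀ k → toℕ (iter σ k x) ≤ toℕ x) → ∀ k' → toℕ (iter π k' (suc x)) ≤ suc (toℕ x)
    bounded max k' with iter-drop k' x
    ... | inj₁ (k , eq) = subst (λ y → toℕ y ≤ suc (toℕ x)) (sym eq) (s≤s (max k))
    ... | inj₂ (eq , _) = subst (λ y → toℕ y ≤ suc (toℕ x)) (sym eq) z≤n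

  sameOrbit-suc : ∀ x z → sameOrbit π (suc x) (suc z) ≡ sameOrbit σ x z
  sameOrbit-suc x z = T-ext
    (λ same → let (k' , eq) = to (T-sameOrbit π (suc x) (suc z)) same in from (T-sameOrbit σ x z) (drop k' eq))
    (λ same → let (k , eq) = to (T-sameOrbit σ x z) same ; (k' , eq') = iter-lift k x in
       from (T-sameOrbit π (suc x) (suc z)) (k' , trans eq' (cong suc eq)))
    where
    drop : ∀ k' → iter π k' (suc x) ≡ suc z → ∃[ k ] iter σ k x ≡ z
    drop k' eq with iter-drop k' x
    ... | inj₁ (k , eq') = k , Finₚ.suc-injective (trans (sym eq') eq)
    ... | inj₂ (eq' , _) = ⊥-elim (0≢1+n (trans (sym eq') eq))

  fixed-orbit : c ≡ zero → ∀ x → ¬ T (sameOrbit π zero (suc x)) × ¬ T (sameOrbit π (suc x) zero)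
  fixed-orbit c≡0 x = from→ , →from
    where
    from→ : ¬ T (sameOrbit π zero (suc x))
    from→ same = let (k , eq) = to (T-sameOrbit π zero (suc x)) same in
      0≢1+n (trans (sym (iter-fixed c≡0 k)) eq)
    →from : ¬ T (sameOrbit π (suc x) zero)
    →from same with to (T-sameOrbit π (suc x) zero) same
    ... | k' , eq with iter-drop k' x
    ...   | inj₁ (k , eq') = 0≢1+n (trans (sym eq) eq')
    ...   | inj₂ (_ , k , c≡) = 0≢1+n (trans (sym c≡0) c≡)

  sameOrbit-zero-c : ∀ y → c ≡ suc y → T (sameOrbit π zero (suc y))
  sameOrbit-zero-c y c≡ = from (T-sameOrbit π zero (suc y)) (1 , c≡)

-- The entries of maxSetBelow are computed by a function local to Defs; unification names it.
maxSetBelow-shape : ∀ {m} n (v : FinMap m) → ∃[ f ] maxSetBelow n v ≡ applyUpTo f n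
maxSetBelow-shape n v = _ , refl

numCycles≡sum : ∀ {m} (v : FinMap m) → numCycles v ≡ sum (λ x → ⟦ isCycleMax v x ⟧)
numCycles≡sum {m} v =
  trans (length-filterᵇ (isCycleMax v) (allFin m)) (sumBy-allFin (λ x → ⟦ isCycleMax v x ⟧))

module _ {m} (c : Fin (suc m)) (σ : FinMap m) where
  open InsertionOrbits c σ

  maxSetBelow-insert₀ : ∀ n → maxSetBelow (suc n) π ≡ (c == zero) ∷ maxSetBelow n σ
  maxSetBelow-insert₀ n = cong₂ _∷_ isCycleMax-zero (applyUpTo-cong shift n)
    where
    shift : ∀ k → proj₁ (maxSetBelow-shape (suc n) π) (suc k) ≡ proj₁ (maxSetBelow-shape n σ) k
    shift k with suc k <? suc m | k <? m
    ... | yes _   | yes _   = isCycleMax-suc _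
    ... | yes k<m | no  k≮m = ⊥-elim (k≮m (s<s⁻¹ k<m))
    ... | no  k≮m | yes k<m = ⊥-elim (k≮m (s<s k<m))
    ... | no  _   | no  _   = refl

  numCycles-insert₀ : numCycles π ≡ ⟦ c == zero ⟧ + numCycles σ
  numCycles-insert₀ = begin
    numCycles π
      ≡⟨ numCycles≡sum π ⟩
    ⟦ isCycleMax π zero ⟧ + sum (λ x → ⟦ isCycleMax π (suc x) ⟧)
      ≡⟨ cong₂ _+_ (cong ⟦_⟧ isCycleMax-zero) (sum-cong-≗ (λ x → cong ⟦_⟧ (isCycleMax-suc x))) ⟩
    ⟦ c == zero ⟧ + sum (λ x → ⟦ isCycleMax σ x ⟧)
      ≡⟨ cong (⟦ c == zero ⟧ +_) (numCycles≡sum σ) ⟨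
    ⟦ c == zero ⟧ + numCycles σ ∎
    where open ≡-Reasoning

  distinctOrbitsFrom-insert₀ : ∀ t → distinctOrbitsFrom (2 + t) π ≡ distinctOrbitsFrom (1 + t) σ
  distinctOrbitsFrom-insert₀ t = T-ext
    (from (T-distinctOrbitsFrom (1 + t) σ) ∘ shrink ∘ to (T-distinctOrbitsFrom (2 + t) π))
    (from (T-distinctOrbitsFrom (2 + t) π) ∘ extend ∘ to (T-distinctOrbitsFrom (1 + t) σ))
    where
    shrink : DistinctOrbitsFrom (2 + t) π → DistinctOrbitsFrom (1 + t) σ
    shrink dist x y t≤x t≤y same = Finₚ.suc-injective
      (dist (suc x) (suc y) (s≤s t≤x) (s≤s t≤y) (subst T (sym (sameOrbit-suc x y)) same))
    extend : DistinctOrbitsFrom (1 + t) σ → DistinctOrbitsFrom (2 + t) π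
    extend dist (suc x) (suc y) t≤x t≤y same =
      cong suc (dist x y (s≤s⁻¹ t≤x) (s≤s⁻¹ t≤y) (subst T (sameOrbit-suc x y) same))
    extend dist zero    _       (s≤s ()) _        _
    extend dist (suc x) zero    _        (s≤s ()) _

  distinctOrbitsFrom≤1-insert₀ : ∀ {t} → t ≤ 1 →
                                 distinctOrbitsFrom t π ≡ (c == zero) ∧ distinctOrbitsFrom 0 σ
  distinctOrbitsFrom≤1-insert₀ {t} t≤1 = T-ext
    (λ dist → let (c≡0 , dist′) = shrink (to (T-distinctOrbitsFrom t π) dist) in
       from T-∧ (fromWitness c≡0 , from (T-distinctOrbitsFrom 0 σ) dist′))
    (λ both → let (c≡0 , dist) = to T-∧ both in
       from (T-distinctOrbitsFrom t π) (extend (toWitness c≡0) (to (T-distinctOrbitsFrom 0 σ) dist)))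
    where
    t≤ : ∀ {k} → t ≤ suc k
    t≤ = ≤-trans t≤1 (s≤s z≤n)
    shrink : DistinctOrbitsFrom t π → c ≡ zero × DistinctOrbitsFrom 0 σ
    shrink dist = c≡0 , λ x y _ _ same →
      Finₚ.suc-injective (dist (suc x) (suc y) t≤ t≤ (subst T (sym (sameOrbit-suc x y)) same))
      where
      c≡0 : c ≡ zero
      c≡0 = fixed c refl
        where
        fixed : ∀ d → c ≡ d → c ≡ zero
        fixed zero    c≡d = c≡d
        fixed (suc y) c≡d = ⊥-elim (0≢1+n (dist zero (suc y) t≤ t≤ (sameOrbit-zero-c y c≡d)))
    extend : c ≡ zero → DistinctOrbitsFrom 0 σ → DistinctOrbitsFrom t π
    extend c≡0 dist zero    zero    _ _ _    = refl
    extend c≡0 dist zero    (suc y) _ _ same = ⊥-elim (proj₁ (fixed-orbit c≡0 y) same)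
    extend c≡0 dist (suc x) zero    _ _ same = ⊥-elim (proj₂ (fixed-orbit c≡0 x) same)
    extend c≡0 dist (suc x) (suc y) _ _ same = cong suc (dist x y z≤n z≤n (subst T (sameOrbit-suc x y) same))

-- One component of an f-Stirling tuple of order (n, j), with a = aᵢ, k = j + aᵢ cycles and S the
-- characteristic list of its cycle maxima below n + 1.
admissible : ∀ {m} → ℕ → ℕ → List Bool → FinMap m → Bool
admissible n k S p = ⌊ numCycles p ℕ.≟ k ⌋ ∧ (maxSetBelow n p ==L S) ∧ distinctOrbitsFrom n p

numAdmissible : ℕ → ℕ → ℕ → List Bool → ℕ
numAdmissible n a k S = ∑[ p ← allPerms (n + a) ] ⟦ admissible n k S p ⟧

numAdmissible-suc : ∀ n a k S → numAdmissible (suc n) a k S ≡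
  ∑[ σ ← allPerms (n + a) ] ⟦ admissible (suc n) k S (insert₀ zero σ) ⟧ +
  sum (λ y → ∑[ σ ← allPerms (n + a) ] ⟦ admissible (suc n) k S (insert₀ (suc y) σ) ⟧)
numAdmissible-suc n a k S = sumBy-allPerms-suc (n + a) (λ p → ⟦ admissible (suc n) k S p ⟧)

module _ {m} (σ : FinMap m) where

  admissible-insert₀ : ∀ n k S c → admissible (suc n) k S (insert₀ c σ) ≡
    ⌊ ⟦ c == zero ⟧ + numCycles σ ℕ.≟ k ⌋ ∧ (((c == zero) ∷ maxSetBelow n σ) ==L S) ∧
    distinctOrbitsFrom (suc n) (insert₀ c σ)
  admissible-insert₀ n k S c rewrite numCycles-insert₀ c σ | maxSetBelow-insert₀ c σ n = refl

  distinctOrbitsFrom-insert₀-zero : ∀ n → distinctOrbitsFrom (suc n) (insert₀ zero σ) ≡ distinctOrbitsFrom n σ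
  distinctOrbitsFrom-insert₀-zero zero    = distinctOrbitsFrom≤1-insert₀ zero σ (s≤s z≤n)
  distinctOrbitsFrom-insert₀-zero (suc n) = distinctOrbitsFrom-insert₀ zero σ n

  admissible-insert₀-fixed : ∀ n k S →
                             admissible (suc n) (suc k) (true ∷ S) (insert₀ zero σ) ≡ admissible n k S σ
  admissible-insert₀-fixed n k S = begin
    admissible (suc n) (suc k) (true ∷ S) (insert₀ zero σ)
      ≡⟨ admissible-insert₀ n (suc k) (true ∷ S) zero ⟩
    ⌊ suc (numCycles σ) ℕ.≟ suc k ⌋ ∧ l ∧ distinctOrbitsFrom (suc n) (insert₀ zero σ)
      ≡⟨ cong₂ (λ b d → b ∧ l ∧ d) (≟-suc (numCycles σ) k) (distinctOrbitsFrom-insert₀-zero n) ⟩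
    admissible n k S σ ∎
    where
    open ≡-Reasoning
    l = maxSetBelow n σ ==L S

  admissible-insert₀-fixed-zero : ∀ n S → admissible (suc n) zero S (insert₀ zero σ) ≡ false
  admissible-insert₀-fixed-zero n S = admissible-insert₀ n zero S zero

  admissible-insert₀-fixed-false : ∀ n k S → admissible (suc n) k (false ∷ S) (insert₀ zero σ) ≡ false
  admissible-insert₀-fixed-false n k S = trans (admissible-insert₀ n k (false ∷ S) zero) (∧-zeroʳ _)

  admissible-insert₀-moved : ∀ n k S y →
                             admissible (2 + n) k (false ∷ S) (insert₀ (suc y) σ) ≡ admissible (suc n) k S σ
  admissible-insert₀-moved n k S y = trans (admissible-insert₀ (suc n) k (false ∷ S) (suc y))
    (cong (λ d → ⌊ numCycles σ ℕ.≟ k ⌋ ∧ (maxSetBelow (suc n) σ ==L S) ∧ d)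
          (distinctOrbitsFrom-insert₀ (suc y) σ n))

  admissible-insert₀-moved-true : ∀ n k S y → admissible (suc n) k (true ∷ S) (insert₀ (suc y) σ) ≡ false
  admissible-insert₀-moved-true n k S y = trans (admissible-insert₀ n k (true ∷ S) (suc y)) (∧-zeroʳ _)

  admissible-insert₀-moved-one : ∀ k S y → admissible 1 k S (insert₀ (suc y) σ) ≡ false
  admissible-insert₀-moved-one k S y = begin
    admissible 1 k S (insert₀ (suc y) σ)               ≡⟨ admissible-insert₀ 0 k S (suc y) ⟩
    b ∧ l ∧ distinctOrbitsFrom 1 (insert₀ (suc y) σ)
      ≡⟨ cong (λ d → b ∧ l ∧ d) (distinctOrbitsFrom≤1-insert₀ (suc y) σ (s≤s z≤n)) ⟩
    b ∧ l ∧ false                                      ≡⟨ cong (b ∧_) (∧-zeroʳ l) ⟩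
    b ∧ false                                          ≡⟨ ∧-zeroʳ b ⟩
    false                                              ∎
    where
    open ≡-Reasoning
    b = ⌊ numCycles σ ℕ.≟ k ⌋
    l = (false ∷ maxSetBelow 0 σ) ==L S

numAdmissible-fixed : ∀ n a k S → numAdmissible (suc n) a (suc k) (true ∷ S) ≡ numAdmissible n a k S
numAdmissible-fixed n a k S = begin
  numAdmissible (suc n) a (suc k) (true ∷ S)
    ≡⟨ numAdmissible-suc n a (suc k) (true ∷ S) ⟩
  ∑[ σ ← perms ] ⟦ adm (insert₀ zero σ) ⟧ + sum (λ y → ∑[ σ ← perms ] ⟦ adm (insert₀ (suc y) σ) ⟧)
    ≡⟨ cong₂ _+_ (sumBy-cong perms (λ σ → cong ⟦_⟧ (admissible-insert₀-fixed σ n k S)))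
                 (sum-zero (λ y → sumBy-zero perms λ σ → cong ⟦_⟧ (admissible-insert₀-moved-true σ n (suc k) S y))) ⟩
  numAdmissible n a k S + 0
    ≡⟨ +-identityʳ _ ⟩
  numAdmissible n a k S ∎
  where
  open ≡-Reasoning
  perms = allPerms (n + a)
  adm = admissible (suc n) (suc k) (true ∷ S)

numAdmissible-fixed-zero : ∀ n a S → numAdmissible (suc n) a zero (true ∷ S) ≡ 0
numAdmissible-fixed-zero n a S = trans (numAdmissible-suc n a zero (true ∷ S)) (cong₂ _+_
  (sumBy-zero perms λ σ → cong ⟦_⟧ (admissible-insert₀-fixed-zero σ n (true ∷ S)))
  (sum-zero (λ y → sumBy-zero perms λ σ → cong ⟦_⟧ (admissible-insert₀-moved-true σ n zero S y))))
  where perms = allPerms (n + a)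

numAdmissible-moved-one : ∀ a k S → numAdmissible 1 a k (false ∷ S) ≡ 0
numAdmissible-moved-one a k S = trans (numAdmissible-suc 0 a k (false ∷ S)) (cong₂ _+_
  (sumBy-zero perms λ σ → cong ⟦_⟧ (admissible-insert₀-fixed-false σ 0 k S))
  (sum-zero (λ y → sumBy-zero perms λ σ → cong ⟦_⟧ (admissible-insert₀-moved-one σ k (false ∷ S) y))))
  where perms = allPerms a

numAdmissible-moved : ∀ n a k S →
                      numAdmissible (2 + n) a k (false ∷ S) ≡ (suc n + a) * numAdmissible (suc n) a k S
numAdmissible-moved n a k S = begin
  numAdmissible (2 + n) a k (false ∷ S)
    ≡⟨ numAdmissible-suc (suc n) a k (false ∷ S) ⟩
  ∑[ σ ← perms ] ⟦ adm (insert₀ zero σ) ⟧ + sum (λ y → ∑[ σ ← perms ] ⟦ adm (insert₀ (suc y) σ) ⟧)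
    ≡⟨ cong₂ _+_ (sumBy-zero perms λ σ → cong ⟦_⟧ (admissible-insert₀-fixed-false σ (suc n) k S))
                 (sum-cong-≗ (λ y → sumBy-cong perms λ σ → cong ⟦_⟧ (admissible-insert₀-moved σ n k S y))) ⟩
  sum {suc n + a} (λ _ → numAdmissible (suc n) a k S)
    ≡⟨ sum-const (suc n + a) _ ⟩
  (suc n + a) * numAdmissible (suc n) a k S ∎
  where
  open ≡-Reasoning
  perms = allPerms (suc n + a)
  adm = admissible (2 + n) k (false ∷ S)

admissible₀-insert₀ : ∀ {m} (c : Fin (suc m)) σ k → admissible 0 k [] (insert₀ c σ) ≡
  ⌊ ⟦ c == zero ⟧ + numCycles σ ℕ.≟ k ⌋ ∧ (c == zero) ∧ distinctOrbitsFrom 0 σ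
admissible₀-insert₀ c σ k rewrite numCycles-insert₀ c σ | distinctOrbitsFrom≤1-insert₀ c σ (z≤n {1}) = refl

numAdmissible-identity : ∀ a k → numAdmissible 0 a k [] ≡ ⟦ ⌊ a ℕ.≟ k ⌋ ⟧
numAdmissible-identity zero    k = trans (+-identityʳ _) (cong ⟦_⟧ (∧-identityʳ _))
numAdmissible-identity (suc a) k = begin
  numAdmissible 0 (suc a) k []
    ≡⟨ sumBy-allPerms-suc a (λ p → ⟦ admissible 0 k [] p ⟧) ⟩
  ∑[ σ ← perms ] ⟦ adm (insert₀ zero σ) ⟧ + sum (λ y → ∑[ σ ← perms ] ⟦ adm (insert₀ (suc y) σ) ⟧)
    ≡⟨ cong₂ _+_ (sumBy-cong perms λ σ → cong ⟦_⟧ (admissible₀-insert₀ zero σ k))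
                 (sum-zero (λ y → sumBy-zero perms λ σ →
                   cong ⟦_⟧ (trans (admissible₀-insert₀ (suc y) σ k) (∧-zeroʳ _)))) ⟩
  ∑[ σ ← perms ] ⟦ ⌊ suc (numCycles σ) ℕ.≟ k ⌋ ∧ distinctOrbitsFrom 0 σ ⟧ + 0
    ≡⟨ +-identityʳ _ ⟩
  ∑[ σ ← perms ] ⟦ ⌊ suc (numCycles σ) ℕ.≟ k ⌋ ∧ distinctOrbitsFrom 0 σ ⟧
    ≡⟨ plus-fixed-point k ⟩
  ⟦ ⌊ suc a ℕ.≟ k ⌋ ⟧ ∎
  where
  open ≡-Reasoning
  perms = allPerms a
  adm = admissible 0 k []
  plus-fixed-point : ∀ k → ∑[ σ ← perms ] ⟦ ⌊ suc (numCycles σ) ℕ.≟ k ⌋ ∧ distinctOrbitsFrom 0 σ ⟧ ≡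
                           ⟦ ⌊ suc a ℕ.≟ k ⌋ ⟧
  plus-fixed-point zero    = sumBy-zero perms (λ _ → refl)
  plus-fixed-point (suc k) = begin
    ∑[ σ ← perms ] ⟦ ⌊ suc (numCycles σ) ℕ.≟ suc k ⌋ ∧ distinctOrbitsFrom 0 σ ⟧
      ≡⟨ sumBy-cong perms (λ σ → cong (λ b → ⟦ b ∧ distinctOrbitsFrom 0 σ ⟧) (≟-suc (numCycles σ) k)) ⟩
    numAdmissible 0 a k []   ≡⟨ numAdmissible-identity a k ⟩
    ⟦ ⌊ a ℕ.≟ k ⌋ ⟧          ≡⟨ cong ⟦_⟧ (≟-suc a k) ⟨
    ⟦ ⌊ suc a ℕ.≟ suc k ⌋ ⟧  ∎

numAdmissible-length : ∀ n a k S → length S ≢ n → numAdmissible n a k S ≡ 0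
numAdmissible-length n a k S ne = sumBy-zero (allPerms (n + a)) λ p → cong ⟦_⟧ (trans
  (cong (λ l → ⌊ numCycles p ℕ.≟ k ⌋ ∧ l ∧ distinctOrbitsFrom n p)
        (==L-length (maxSetBelow n p) S (λ eq → ne (trans (sym eq) (length-applyUpTo _ n)))))
  (∧-zeroʳ _))

numAdmissible-few-cycles : ∀ n a k S → k < a → numAdmissible n a k S ≡ 0
numAdmissible-few-cycles zero          a k       []          k<a =
  trans (numAdmissible-identity a k) (cong ⟦_⟧ (≟-≢ (>⇒≢ k<a)))
numAdmissible-few-cycles zero          a k       S@(_ ∷ _)   _   = numAdmissible-length 0 a k S (λ ())
numAdmissible-few-cycles (suc n)       a k       []          _   = numAdmissible-length (suc n) a k [] (λ ())
numAdmissible-few-cycles (suc n)       a zero    (true ∷ S)  _   = numAdmissible-fixed-zero n a S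
numAdmissible-few-cycles (suc n)       a (suc k) (true ∷ S)  k<a =
  trans (numAdmissible-fixed n a k S) (numAdmissible-few-cycles n a k S (<-trans (n<1+n k) k<a))
numAdmissible-few-cycles (suc zero)    a k       (false ∷ S) _   = numAdmissible-moved-one a k S
numAdmissible-few-cycles (suc (suc n)) a k       (false ∷ S) k<a = begin
  numAdmissible (2 + n) a k (false ∷ S)      ≡⟨ numAdmissible-moved n a k S ⟩
  (suc n + a) * numAdmissible (suc n) a k S  ≡⟨ cong ((suc n + a) *_) (numAdmissible-few-cycles (suc n) a k S k<a) ⟩
  (suc n + a) * 0                            ≡⟨ *-zeroʳ (suc n + a) ⟩
  0                                          ∎
  where open ≡-Reasoning

numAdmissibleTuples : ∀ {r} → ℕ → ℕ → List Bool → Vec ℕ r → ℕ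
numAdmissibleTuples n j S []       = 1
numAdmissibleTuples n j S (a ∷ as) = numAdmissible n a (j + a) S * numAdmissibleTuples n j S as

sumBy-allTuples : ∀ n {r} a (as : Vec ℕ r) (g : Tuple n (a ∷ as) → ℕ) →
                  sumBy (allTuples n (a ∷ as)) g ≡ ∑[ p ← allPerms (n + a) ] ∑[ ps ← allTuples n as ] g (p , ps)
sumBy-allTuples n a as g = trans (sumBy-concatMap _ (allPerms (n + a)) g)
  (sumBy-cong (allPerms (n + a)) (λ p → sumBy-map (p ,_) (allTuples n as) g))

condAll-cons : ∀ n j S {r} a (as : Vec ℕ r) p ps →
               condAll n j S (a ∷ as) (p , ps) ≡ admissible n (j + a) S p ∧ condAll n j S as ps
condAll-cons n j S a as p ps = sym (trans (∧-assoc b (l ∧ d) rest) (cong (b ∧_) (∧-assoc l d rest)))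
  where
  b = ⌊ numCycles p ℕ.≟ j + a ⌋
  l = maxSetBelow n p ==L S
  d = distinctOrbitsFrom n p
  rest = condAll n j S as ps

sumBy-condAll-cons : ∀ n j S {r} a (as : Vec ℕ r) p →
                     ∑[ ps ← allTuples n as ] ⟦ condAll n j S (a ∷ as) (p , ps) ⟧ ≡
                     ⟦ admissible n (j + a) S p ⟧ * numAdmissibleTuples n j S as
sumBy-condAll : ∀ n j S {r} (as : Vec ℕ r) →
                ∑[ ps ← allTuples n as ] ⟦ condAll n j S as ps ⟧ ≡ numAdmissibleTuples n j S as

sumBy-condAll-cons n j S a as p = begin
  ∑[ ps ← allTuples n as ] ⟦ condAll n j S (a ∷ as) (p , ps) ⟧
    ≡⟨ sumBy-cong (allTuples n as) (λ ps → trans (cong ⟦_⟧ (condAll-cons n j S a as p ps)) (⟦∧⟧ adm _)) ⟩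
  ∑[ ps ← allTuples n as ] (⟦ adm ⟧ * ⟦ condAll n j S as ps ⟧)
    ≡⟨ sumBy-*ˡ (allTuples n as) ⟦ adm ⟧ (λ ps → ⟦ condAll n j S as ps ⟧) ⟩
  ⟦ adm ⟧ * ∑[ ps ← allTuples n as ] ⟦ condAll n j S as ps ⟧
    ≡⟨ cong (⟦ adm ⟧ *_) (sumBy-condAll n j S as) ⟩
  ⟦ adm ⟧ * numAdmissibleTuples n j S as ∎
  where
  open ≡-Reasoning
  adm = admissible n (j + a) S p

sumBy-condAll n j S []       = refl
sumBy-condAll n j S (a ∷ as) = begin
  ∑[ ps ← allTuples n (a ∷ as) ] ⟦ condAll n j S (a ∷ as) ps ⟧
    ≡⟨ sumBy-allTuples n a as (λ ps → ⟦ condAll n j S (a ∷ as) ps ⟧) ⟩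
  ∑[ p ← allPerms (n + a) ] ∑[ ps ← allTuples n as ] ⟦ condAll n j S (a ∷ as) (p , ps) ⟧
    ≡⟨ sumBy-cong (allPerms (n + a)) (sumBy-condAll-cons n j S a as) ⟩
  ∑[ p ← allPerms (n + a) ] (⟦ admissible n (j + a) S p ⟧ * numAdmissibleTuples n j S as)
    ≡⟨ sumBy-*ʳ (allPerms (n + a)) (λ p → ⟦ admissible n (j + a) S p ⟧) (numAdmissibleTuples n j S as) ⟩
  numAdmissibleTuples n j S (a ∷ as) ∎
  where open ≡-Reasoning

numAdmissibleTuples-fixed : ∀ n j S {r} (as : Vec ℕ r) →
                            numAdmissibleTuples (suc n) (suc j) (true ∷ S) as ≡ numAdmissibleTuples n j S as
numAdmissibleTuples-fixed n j S []       = refl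
numAdmissibleTuples-fixed n j S (a ∷ as) =
  cong₂ _*_ (numAdmissible-fixed n a (j + a) S) (numAdmissibleTuples-fixed n j S as)

numAdmissibleTuples-fixed-zero : ∀ n S {r} a (as : Vec ℕ r) →
                                 numAdmissibleTuples (suc n) 0 (true ∷ S) (a ∷ as) ≡ 0
numAdmissibleTuples-fixed-zero n S a as = cong (_* numAdmissibleTuples (suc n) 0 (true ∷ S) as) (too-few a)
  where
  too-few : ∀ a → numAdmissible (suc n) a a (true ∷ S) ≡ 0
  too-few zero    = numAdmissible-fixed-zero n 0 S
  too-few (suc a) = trans (numAdmissible-fixed n (suc a) a S) (numAdmissible-few-cycles n (suc a) a S (n<1+n a))

numAdmissibleTuples-moved-one : ∀ j S {r} a (as : Vec ℕ r) → numAdmissibleTuples 1 j (false ∷ S) (a ∷ as) ≡ 0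
numAdmissibleTuples-moved-one j S a as =
  cong (_* numAdmissibleTuples 1 j (false ∷ S) as) (numAdmissible-moved-one a (j + a) S)

numAdmissibleTuples-moved : ∀ n j S {r} (as : Vec ℕ r) →
  numAdmissibleTuples (2 + n) j (false ∷ S) as ≡ fpoly as (suc n) * numAdmissibleTuples (suc n) j S as
numAdmissibleTuples-moved n j S []       = sym (+-identityʳ _)
numAdmissibleTuples-moved n j S (a ∷ as) = trans
  (cong₂ _*_ (numAdmissible-moved n a (j + a) S) (numAdmissibleTuples-moved n j S as))
  (*-interchange (suc n + a) (numAdmissible (suc n) a (j + a) S) (fpoly as (suc n)) _)

allBitLists : ℕ → List (List Bool)
allBitLists zero    = [ [] ]
allBitLists (suc n) = map (true ∷_) (allBitLists n) ++ map (false ∷_) (allBitLists n)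

sumBy-allBitLists-suc : ∀ n (g : List Bool → ℕ) →
  sumBy (allBitLists (suc n)) g ≡ ∑[ S ← allBitLists n ] g (true ∷ S) + ∑[ S ← allBitLists n ] g (false ∷ S)
sumBy-allBitLists-suc n g = trans (sumBy-++ (map (true ∷_) (allBitLists n)) _ g)
  (cong₂ _+_ (sumBy-map (true ∷_) (allBitLists n) g) (sumBy-map (false ∷_) (allBitLists n) g))

sumBy-allBitLists-select : ∀ n L → length L ≡ n → (g : List Bool → ℕ) →
                           ∑[ S ← allBitLists n ] (⟦ L ==L S ⟧ * g S) ≡ g L
sumBy-allBitLists-select zero    []          _   g = trans (+-identityʳ _) (+-identityʳ _)
sumBy-allBitLists-select (suc n) (true ∷ L)  len g = begin
  ∑[ S ← allBitLists (suc n) ] (⟦ (true ∷ L) ==L S ⟧ * g S)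
    ≡⟨ sumBy-allBitLists-suc n _ ⟩
  ∑[ S ← allBitLists n ] (⟦ L ==L S ⟧ * g (true ∷ S)) + ∑[ S ← allBitLists n ] 0
    ≡⟨ cong₂ _+_ (sumBy-allBitLists-select n L (suc-injective len) (g ∘ (true ∷_)))
                 (sumBy-zero (allBitLists n) (λ _ → refl)) ⟩
  g (true ∷ L) + 0
    ≡⟨ +-identityʳ _ ⟩
  g (true ∷ L) ∎
  where open ≡-Reasoning
sumBy-allBitLists-select (suc n) (false ∷ L) len g = begin
  ∑[ S ← allBitLists (suc n) ] (⟦ (false ∷ L) ==L S ⟧ * g S)
    ≡⟨ sumBy-allBitLists-suc n _ ⟩
  ∑[ S ← allBitLists n ] 0 + ∑[ S ← allBitLists n ] (⟦ L ==L S ⟧ * g (false ∷ S))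
    ≡⟨ cong₂ _+_ (sumBy-zero (allBitLists n) (λ _ → refl))
                 (sumBy-allBitLists-select n L (suc-injective len) (g ∘ (false ∷_))) ⟩
  g (false ∷ L) ∎
  where open ≡-Reasoning

stirlingSum : ∀ {r} → ℕ → ℕ → Vec ℕ r → ℕ
stirlingSum n j as = ∑[ S ← allBitLists n ] numAdmissibleTuples n j S as

⟦l⟧*⟦b∧l∧d⟧ : ∀ b l d → ⟦ l ⟧ * ⟦ b ∧ l ∧ d ⟧ ≡ ⟦ b ∧ l ∧ d ⟧
⟦l⟧*⟦b∧l∧d⟧ b true  d = +-identityʳ _
⟦l⟧*⟦b∧l∧d⟧ b false d = cong ⟦_⟧ (sym (∧-zeroʳ b))

-- Condition (b) is resolved by summing over the common set S of cycle maxima; for fixed S the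
-- components are independent.
numFStirling≡stirlingSum : ∀ n j {r} a (as : Vec ℕ r) → numFStirling (a ∷ as) n j ≡ stirlingSum n j (a ∷ as)
numFStirling≡stirlingSum n j a as = begin
  numFStirling (a ∷ as) n j
    ≡⟨ length-filterᵇ (isFStirling n j (a ∷ as)) (allTuples n (a ∷ as)) ⟩
  ∑[ ps ← allTuples n (a ∷ as) ] ⟦ isFStirling n j (a ∷ as) ps ⟧
    ≡⟨ sumBy-allTuples n a as (λ ps → ⟦ isFStirling n j (a ∷ as) ps ⟧) ⟩
  ∑[ p ← perms ] ∑[ ps ← allTuples n as ] ⟦ condAll n j (maxSetBelow n p) (a ∷ as) (p , ps) ⟧
    ≡⟨ sumBy-cong perms (λ p → sumBy-condAll-cons n j (maxSetBelow n p) a as p) ⟩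
  ∑[ p ← perms ] weight (maxSetBelow n p) p
    ≡⟨ sumBy-cong perms (λ p →
         sumBy-allBitLists-select n (maxSetBelow n p) (length-applyUpTo _ n) (λ S → weight S p)) ⟨
  ∑[ p ← perms ] ∑[ S ← allBitLists n ] (⟦ maxSetBelow n p ==L S ⟧ * weight S p)
    ≡⟨ sumBy-cong perms (λ p → sumBy-cong (allBitLists n) (selected p)) ⟩
  ∑[ p ← perms ] ∑[ S ← allBitLists n ] weight S p
    ≡⟨ sumBy-comm perms (allBitLists n) (λ p S → weight S p) ⟩
  ∑[ S ← allBitLists n ] ∑[ p ← perms ] weight S p
    ≡⟨ sumBy-cong (allBitLists n) (λ S → sumBy-*ʳ perms (λ p → ⟦ admissible n (j + a) S p ⟧) _) ⟩
  stirlingSum n j (a ∷ as) ∎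
  where
  open ≡-Reasoning
  perms = allPerms (n + a)
  weight : List Bool → FinMap (n + a) → ℕ
  weight S p = ⟦ admissible n (j + a) S p ⟧ * numAdmissibleTuples n j S as
  selected : ∀ p S → ⟦ maxSetBelow n p ==L S ⟧ * weight S p ≡ weight S p
  selected p S = trans (sym (*-assoc ⟦ l ⟧ ⟦ admissible n (j + a) S p ⟧ _))
    (cong (_* numAdmissibleTuples n j S as) (⟦l⟧*⟦b∧l∧d⟧ ⌊ numCycles p ℕ.≟ j + a ⌋ l (distinctOrbitsFrom n p)))
    where l = maxSetBelow n p ==L S

-- Elementary symmetric polynomials

esym-∷ʳ : ∀ m xs y → esym (suc m) (xs ∷ʳ y) ≡ esym (suc m) xs + y * esym m xs
esym-∷ʳ m       []       y = +-identityʳ _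
esym-∷ʳ zero    (x ∷ xs) y rewrite esym-∷ʳ zero xs y = sym (+-assoc (x * 1) (esym 1 xs) (y * 1))
esym-∷ʳ (suc m) (x ∷ xs) y rewrite esym-∷ʳ (suc m) xs y | esym-∷ʳ m xs y =
  regroup x (esym (suc m) xs) y (esym m xs) (esym (2 + m) xs)
  where
  regroup : ∀ x e₁ y e₀ e₂ → x * (e₁ + y * e₀) + (e₂ + y * e₁) ≡ x * e₁ + e₂ + y * (x * e₀ + e₁)
  regroup = solve-∀

esym-length : ∀ m xs → length xs < m → esym m xs ≡ 0
esym-length (suc m)       []       _         = refl
esym-length (suc zero)    (x ∷ xs) (s≤s ())
esym-length (suc (suc m)) (x ∷ xs) (s≤s len<) rewrite esym-length (suc m) xs len<
  | esym-length (suc (suc m)) xs (<-trans len< (n<1+n _)) = trans (+-identityʳ (x * 0)) (*-zeroʳ x)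

esymZ-suc : ∀ N j xs → esymZ (suc N) (suc j) xs ≡ esymZ N j xs
esymZ-suc N j xs = cong (λ b → if b then esym (N ∸ j) xs else 0)
  (T-ext (fromWitness ∘ s≤s⁻¹ ∘ toWitness) (fromWitness ∘ s≤s ∘ toWitness))

esymZ-∷ʳ : ∀ N j xs y → esymZ N j (xs ∷ʳ y) ≡ esymZ N j xs + y * esymZ N (suc j) xs
esymZ-∷ʳ zero    zero    xs y = sym (cong suc (*-zeroʳ y))
esymZ-∷ʳ (suc N) zero    xs y = esym-∷ʳ N xs y
esymZ-∷ʳ zero    (suc j) xs y = sym (*-zeroʳ y)
esymZ-∷ʳ (suc N) (suc j) xs y
  rewrite esymZ-suc N j (xs ∷ʳ y) | esymZ-suc N j xs | esymZ-suc N (suc j) xs = esymZ-∷ʳ N j xs y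

module _ {r} (shifts : Vec ℕ r) where

  private
    f : ℕ → ℕ
    f = fpoly shifts
    fValues : ℕ → List ℕ
    fValues n = applyUpTo (λ k → f (suc k)) n

  E-one-suc : ∀ j → E shifts (suc j) 1 ≡ E shifts j 0
  E-one-suc zero    = refl
  E-one-suc (suc j) = refl

  E-suc-suc : ∀ n j → E shifts j (2 + n) ≡ esymZ (2 + n) j (fValues n) + f (suc n) * E shifts j (suc n)
  E-suc-suc n j = begin
    esymZ (2 + n) j (fValues (suc n))
      ≡⟨ cong (esymZ (2 + n) j) (applyUpTo-∷ʳ _ n) ⟨
    esymZ (2 + n) j (fValues n ∷ʳ f (suc n))
      ≡⟨ esymZ-∷ʳ (2 + n) j (fValues n) (f (suc n)) ⟩
    esymZ (2 + n) j (fValues n) + f (suc n) * esymZ (2 + n) (suc j) (fValues n)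
      ≡⟨ cong (λ e → esymZ (2 + n) j (fValues n) + f (suc n) * e) (esymZ-suc (suc n) j (fValues n)) ⟩
    esymZ (2 + n) j (fValues n) + f (suc n) * E shifts j (suc n) ∎
    where open ≡-Reasoning

  E-suc-suc-zero : ∀ n → E shifts 0 (2 + n) ≡ f (suc n) * E shifts 0 (suc n)
  E-suc-suc-zero n = trans (E-suc-suc n 0) (cong (_+ f (suc n) * E shifts 0 (suc n))
    (esym-length (2 + n) (fValues n) (s≤s (≤-trans (≤-reflexive (length-applyUpTo _ n)) (n≤1+n n)))))

  E-suc-suc-suc : ∀ n j → E shifts (suc j) (2 + n) ≡ E shifts j (suc n) + f (suc n) * E shifts (suc j) (suc n)
  E-suc-suc-suc n j = trans (E-suc-suc n (suc j))
    (cong (_+ f (suc n) * E shifts (suc j) (suc n)) (esymZ-suc (suc n) j (fValues n)))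

-- The recursion

module _ {r} (a : ℕ) (as : Vec ℕ r) where

  private
    shifts = a ∷ as
    f : ℕ → ℕ
    f = fpoly shifts
    fixedPart movedPart : ℕ → ℕ → ℕ
    fixedPart n j = ∑[ S ← allBitLists n ] numAdmissibleTuples (suc n) j (true ∷ S) shifts
    movedPart n j = ∑[ S ← allBitLists n ] numAdmissibleTuples (suc n) j (false ∷ S) shifts

  stirlingSum-zero-zero : stirlingSum 0 0 shifts ≡ 1
  stirlingSum-zero-zero = trans (+-identityʳ _) (identities shifts)
    where
    identities : ∀ {r} (as : Vec ℕ r) → numAdmissibleTuples 0 0 [] as ≡ 1
    identities []       = refl
    identities (a ∷ as) = cong₂ _*_ (trans (numAdmissible-identity a a) (cong ⟦_⟧ (≟-refl a))) (identities as)

  stirlingSum-zero-suc : ∀ j → stirlingSum 0 (suc j) shifts ≡ 0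
  stirlingSum-zero-suc j = trans (+-identityʳ _) (cong (_* numAdmissibleTuples 0 (suc j) [] as)
    (trans (numAdmissible-identity a (suc j + a)) (cong ⟦_⟧ (≟-≢ (m≢1+n+m a)))))

  stirlingSum-suc : ∀ n j → stirlingSum (suc n) j shifts ≡ fixedPart n j + movedPart n j
  stirlingSum-suc n j = sumBy-allBitLists-suc n (λ S → numAdmissibleTuples (suc n) j S shifts)

  fixedPart-zero : ∀ n → fixedPart n 0 ≡ 0
  fixedPart-zero n = sumBy-zero (allBitLists n) (λ S → numAdmissibleTuples-fixed-zero n S a as)

  fixedPart-suc : ∀ n j → fixedPart n (suc j) ≡ stirlingSum n j shifts
  fixedPart-suc n j = sumBy-cong (allBitLists n) (λ S → numAdmissibleTuples-fixed n j S shifts)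

  movedPart-zero : ∀ j → movedPart 0 j ≡ 0
  movedPart-zero j = trans (+-identityʳ _) (numAdmissibleTuples-moved-one j [] a as)

  movedPart-suc : ∀ n j → movedPart (suc n) j ≡ f (suc n) * stirlingSum (suc n) j shifts
  movedPart-suc n j = trans (sumBy-cong (allBitLists (suc n)) (λ S → numAdmissibleTuples-moved n j S shifts))
    (sumBy-*ˡ (allBitLists (suc n)) (f (suc n)) (λ S → numAdmissibleTuples (suc n) j S shifts))

  stirlingSum≡E : ∀ n j → stirlingSum n j shifts ≡ E shifts j n
  stirlingSum≡E zero          zero    = stirlingSum-zero-zero
  stirlingSum≡E zero          (suc j) = stirlingSum-zero-suc j
  stirlingSum≡E (suc zero)    zero    =
    trans (stirlingSum-suc 0 0) (cong₂ _+_ (fixedPart-zero 0) (movedPart-zero 0))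
  stirlingSum≡E (suc zero)    (suc j) = begin
    stirlingSum 1 (suc j) shifts                ≡⟨ stirlingSum-suc 0 (suc j) ⟩
    fixedPart 0 (suc j) + movedPart 0 (suc j)   ≡⟨ cong₂ _+_ (fixedPart-suc 0 j) (movedPart-zero (suc j)) ⟩
    stirlingSum 0 j shifts + 0                  ≡⟨ +-identityʳ _ ⟩
    stirlingSum 0 j shifts                      ≡⟨ stirlingSum≡E 0 j ⟩
    E shifts j 0                                ≡⟨ E-one-suc shifts j ⟨
    E shifts (suc j) 1                          ∎
    where open ≡-Reasoning
  stirlingSum≡E (suc (suc n)) zero    = begin
    stirlingSum (2 + n) 0 shifts                ≡⟨ stirlingSum-suc (suc n) 0 ⟩
    fixedPart (suc n) 0 + movedPart (suc n) 0   ≡⟨ cong₂ _+_ (fixedPart-zero (suc n)) (movedPart-suc n 0) ⟩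
    f (suc n) * stirlingSum (suc n) 0 shifts    ≡⟨ cong (f (suc n) *_) (stirlingSum≡E (suc n) 0) ⟩
    f (suc n) * E shifts 0 (suc n)              ≡⟨ E-suc-suc-zero shifts n ⟨
    E shifts 0 (2 + n)                          ∎
    where open ≡-Reasoning
  stirlingSum≡E (suc (suc n)) (suc j) = begin
    stirlingSum (2 + n) (suc j) shifts
      ≡⟨ stirlingSum-suc (suc n) (suc j) ⟩
    fixedPart (suc n) (suc j) + movedPart (suc n) (suc j)
      ≡⟨ cong₂ _+_ (fixedPart-suc (suc n) j) (movedPart-suc n (suc j)) ⟩
    stirlingSum (suc n) j shifts + f (suc n) * stirlingSum (suc n) (suc j) shifts
      ≡⟨ cong₂ (λ x y → x + f (suc n) * y) (stirlingSum≡E (suc n) j) (stirlingSum≡E (suc n) (suc j)) ⟩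
    E shifts j (suc n) + f (suc n) * E shifts (suc j) (suc n)
      ≡⟨ E-suc-suc-suc shifts n j ⟨
    E shifts (suc j) (2 + n) ∎
    where open ≡-Reasoning

corollaryC : (r : ℕ) → 1 ≤ r → (a : Vec ℕ r) →
    (∀ (i k : Fin r) → i Fin.≤ k → lookup a i ≤ lookup a k) →
    ∀ (j n : ℕ) → E a j n ≡ numFStirling a n j
corollaryC (suc r) _ (a ∷ as) _ j n =
  trans (sym (stirlingSum≡E a as n j)) (sym (numFStirling≡stirlingSum n j a as))
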